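{- For each set $X$, let $[2^X,2]_{\bigvee}$ denote the set of join-preserving maps $2^X\to 2$, where $2=\{0<1\}$ and $2^X$ carries the pointwise order. The assignment $X\mapsto[2^X,2]_{\bigvee}$ is a monad on $\mathbf{Set}$ with action on a function $g\colon X\to Y$ given by $\xi\mapsto\lambda h.\,\xi(h\circ g)$, unit $\eta_X(x)=\lambda f.\,f(x)$ and multiplication $\mu_X(\Xi)=\lambda f.\,\Xi(\lambda\xi.\,\xi(f))$. Then the family of maps $\sigma_X\colon\mathcal{P}X\to[2^X,2]_{\bigvee}$, $\sigma_X(S)=\lambda f.\,\bigvee_{x\in S}f(x)$, is an isomorphism of monads from the powerset monad $\mathcal{P}$ to $[2^{(-)},2]_{\bigvee}$.
   Context: $\mathcal{P}$ is the powerset monad on $\mathbf{Set}$ (unit $x\mapsto\{x\}$, multiplication union). A monad map (morphism of monads) is a natural transformation commuting with units and multiplications; an isomorphism of monads is a monad map whose components are bijections. -}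

module Defs where

open import Level using (0ℓ)
open import Data.Bool using (Bool; true; false; _≤_)
open import Data.Product using (Σ; ∃; _×_; _,_; proj₁; proj₂)
open import Function using (_∘_; id)
open import Function.Definitions using (Bijective)
open import Relation.Binary.PropositionalEquality using (_≡_)
open import Relation.Nullary using (does)
open import Axiom.ExcludedMiddle using (ExcludedMiddle)

_≤ᵖ_ : {X : Set} → (X → Bool) → (X → Bool) → Set
f ≤ᵖ g = ∀ x → f x ≤ g x

IsLub : {A : Set} → (A → A → Set) → (A → Set) → A → Set
IsLub {A} _⊑_ S a =
  (∀ b → S b → b ⊑ a) × (∀ c → (∀ b → S b → b ⊑ c) → a ⊑ c)

JoinPreserving : {X : Set} → ((X → Bool) → Bool) → Set
JoinPreserving {X} ξ =
  ∀ (S : (X → Bool) → Bool) (g : X → Bool) →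
  IsLub _≤ᵖ_ (λ f → S f ≡ true) g →
  IsLub _≤_ (λ b → ∃ λ f → S f ≡ true × ξ f ≡ b) (ξ g)

T : Set → Set
T X = Σ ((X → Bool) → Bool) JoinPreserving

record RawMonadOn : Set₁ where
  field
    F    : Set → Set
    fmap : ∀ {X Y : Set} → (X → Y) → F X → F Y
    unit : ∀ {X : Set} → X → F X
    join : ∀ {X : Set} → F (F X) → F X

record IsMonad (M : RawMonadOn) : Set₁ where
  open RawMonadOn M
  field
    fmap-id    : ∀ {X : Set} (a : F X) → fmap id a ≡ a
    fmap-∘     : ∀ {X Y Z : Set} (f : X → Y) (g : Y → Z) (a : F X) →
                 fmap (g ∘ f) a ≡ fmap g (fmap f a)
    unit-nat   : ∀ {X Y : Set} (f : X → Y) (x : X) → fmap f (unit x) ≡ unit (f x)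
    join-nat   : ∀ {X Y : Set} (f : X → Y) (a : F (F X)) →
                 fmap f (join a) ≡ join (fmap (fmap f) a)
    left-unit  : ∀ {X : Set} (a : F X) → join (unit a) ≡ a
    right-unit : ∀ {X : Set} (a : F X) → join (fmap unit a) ≡ a
    assoc      : ∀ {X : Set} (a : F (F (F X))) → join (join a) ≡ join (fmap join a)

record IsMonadIso (M N : RawMonadOn)
                  (σ : ∀ {X : Set} → RawMonadOn.F M X → RawMonadOn.F N X) : Set₁ where
  private
    module M = RawMonadOn M
    module N = RawMonadOn N
  field
    natural   : ∀ {X Y : Set} (f : X → Y) (a : M.F X) → σ (M.fmap f a) ≡ N.fmap f (σ a)
    unit-pres : ∀ {X : Set} (x : X) → σ (M.unit x) ≡ N.unit x
    join-pres : ∀ {X : Set} (a : M.F (M.F X)) → σ (M.join a) ≡ N.join (N.fmap σ (σ a))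
    bijective : ∀ {X : Set} → Bijective {A = M.F X} {B = N.F X} _≡_ _≡_ σ

tmapʳ : {X Y : Set} → (X → Y) → ((X → Bool) → Bool) → ((Y → Bool) → Bool)
tmapʳ g ξ h = ξ (h ∘ g)

etaʳ : {X : Set} → X → ((X → Bool) → Bool)
etaʳ x f = f x

muʳ : {X : Set} → ((T X → Bool) → Bool) → ((X → Bool) → Bool)
muʳ Ξ f = Ξ (λ ξ → proj₁ ξ f)

record WellDefined : Set₁ where
  field
    tmap-jp : ∀ {X Y : Set} (g : X → Y) (ξ : T X) → JoinPreserving (tmapʳ g (proj₁ ξ))
    eta-jp  : ∀ {X : Set} (x : X) → JoinPreserving (etaʳ x)
    mu-jp   : ∀ {X : Set} (Ξ : T (T X)) → JoinPreserving (muʳ (proj₁ Ξ))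

TMonad : WellDefined → RawMonadOn
TMonad wd = record
  { F    = T
  ; fmap = λ g ξ → tmapʳ g (proj₁ ξ) , tmap-jp g ξ
  ; unit = λ x → etaʳ x , eta-jp x
  ; join = λ Ξ → muʳ (proj₁ Ξ) , mu-jp Ξ
  }
  where open WellDefined wd

-- Classical part: the powerset monad (subsets as characteristic
-- functions, which is the full powerset under excluded middle) and σ.

module Classical (lem : ExcludedMiddle 0ℓ) where

  ⟦_⟧ : Set → Bool
  ⟦ P ⟧ = does (lem {P})

  𝒫 : Set → Set
  𝒫 X = X → Bool

  𝒫map : {X Y : Set} → (X → Y) → 𝒫 X → 𝒫 Y
  𝒫map g S y = ⟦ ∃ (λ x → S x ≡ true × g x ≡ y) ⟧

  𝒫η : {X : Set} → X → 𝒫 X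
  𝒫η x y = ⟦ y ≡ x ⟧

  𝒫μ : {X : Set} → 𝒫 (𝒫 X) → 𝒫 X
  𝒫μ 𝒮 x = ⟦ ∃ (λ S → 𝒮 S ≡ true × S x ≡ true) ⟧

  PowMonad : RawMonadOn
  PowMonad = record { F = 𝒫 ; fmap = 𝒫map ; unit = 𝒫η ; join = 𝒫μ }

  σʳ : {X : Set} → 𝒫 X → ((X → Bool) → Bool)
  σʳ S f = ⟦ ∃ (λ x → S x ≡ true × f x ≡ true) ⟧

-- Every f : 2^X is the join of the χ_{x} with f x = 1, so a join-preserving
-- ξ satisfies ξ f = 1 iff f meets its support {x | ξ(χ_{x}) = 1}, i.e.
-- ξ = σ(support ξ): σ is a bijection.  The monad-map equations for σ are
-- equivalences between existential statements, which excluded middle turns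
-- into equalities in 2.  The formulas defining [2^(-),2]_⋁ land in
-- join-preserving maps because, transported along σ, they become direct
-- image, singleton and union.
module Submission where

open import Defs
open import Level using (0ℓ)
open import Data.Bool using (Bool; true; false; _≤_; b≤b)
open import Data.Bool.Properties using (≤-minimum; ≤-irrelevant)
open import Data.Product using (Σ-syntax; ∃; _×_; _,_; proj₁; proj₂)
open import Data.Empty using (⊥-elim)
open import Function using (_∘_)
open import Function.Bundles using (_⇔_; mk⇔; module Equivalence)
open import Function.Properties.Equivalence using () renaming (sym to ⇔-sym; trans to ⇔-trans)
open import Function.Consequences.Propositional
  using (inverseᵇ⇒bijective; strictlyInverseˡ⇒inverseˡ; strictlyInverseʳ⇒inverseʳ)
open import Relation.Nullary using (yes; no; ¬_)
open import Relation.Binary.PropositionalEquality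
open import Axiom.ExcludedMiddle using (ExcludedMiddle)
open import Axiom.Extensionality.Propositional using (Extensionality)

open Equivalence using (to; from)

≤⇒true→true : {a b : Bool} → a ≤ b → a ≡ true → b ≡ true
≤⇒true→true b≤b a≡true = a≡true

true→true⇒≤ : {a b : Bool} → (a ≡ true → b ≡ true) → a ≤ b
true→true⇒≤ {false} {b} _ = ≤-minimum b
true→true⇒≤ {true}      h with h refl
... | refl = b≤b

Intersects : {A : Set} → (A → Bool) → (A → Bool) → Set
Intersects {A} S f = ∃ λ (a : A) → S a ≡ true × f a ≡ true

intersects-comm : {A : Set} {S f : A → Bool} → Intersects S f ⇔ Intersects f S
intersects-comm = mk⇔ (λ (a , Sa , fa) → a , fa , Sa) (λ (a , fa , Sa) → a , Sa , fa)

IsUnion : {X : Set} → ((X → Bool) → Bool) → (X → Bool) → Set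
IsUnion 𝒮 g = ∀ x → g x ≡ true ⇔ Intersects 𝒮 (λ f → f x)

PreservesUnions : {X : Set} → ((X → Bool) → Bool) → Set
PreservesUnions {X} ξ =
  ∀ (𝒮 : (X → Bool) → Bool) g → IsUnion 𝒮 g → ξ g ≡ true ⇔ Intersects 𝒮 ξ

joinPreserving-irrelevant : Extensionality 0ℓ 0ℓ → {X : Set} {ξ : (X → Bool) → Bool} →
  (p q : JoinPreserving ξ) → p ≡ q
joinPreserving-irrelevant ext p q = ext λ 𝒮 → ext λ g → ext λ g-lub →
  cong₂ _,_ (≤-irrelevant-∀∀ (proj₁ (p 𝒮 g g-lub)) (proj₁ (q 𝒮 g g-lub)))
            (≤-irrelevant-∀∀ (proj₂ (p 𝒮 g g-lub)) (proj₂ (q 𝒮 g g-lub)))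
  where
    ≤-irrelevant-∀∀ : {A : Set} {B : A → Set} {c d : A → Bool} →
      (u v : ∀ a → B a → c a ≤ d a) → u ≡ v
    ≤-irrelevant-∀∀ u v = ext λ a → ext λ b → ≤-irrelevant (u a b) (v a b)

T-≡ : Extensionality 0ℓ 0ℓ → {X : Set} {ξ ζ : T X} → proj₁ ξ ≡ proj₁ ζ → ξ ≡ ζ
T-≡ ext {ξ = ξ , p} {.ξ , q} refl = cong (ξ ,_) (joinPreserving-irrelevant ext p q)

module Correspondence (lem : ExcludedMiddle 0ℓ) (ext : Extensionality 0ℓ 0ℓ) where
  open Classical lem

  ⟦⟧≡true⇔ : {P : Set} → ⟦ P ⟧ ≡ true ⇔ P
  ⟦⟧≡true⇔ {P} with lem {P}
  ... | yes p = mk⇔ (λ _ → p) (λ _ → refl)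
  ... | no ¬p = mk⇔ (λ ()) (⊥-elim ∘ ¬p)

  ≡⟦⟧ : {b : Bool} {P : Set} → b ≡ true ⇔ P → b ≡ ⟦ P ⟧
  ≡⟦⟧ {false} {P} b⇔P with lem {P}
  ... | yes p = from b⇔P p
  ... | no _  = refl
  ≡⟦⟧ {true} b⇔P = sym (from ⟦⟧≡true⇔ (to b⇔P refl))

  ⟦⟧-cong : {P Q : Set} → P ⇔ Q → ⟦ P ⟧ ≡ ⟦ Q ⟧
  ⟦⟧-cong P⇔Q = ≡⟦⟧ (⇔-trans ⟦⟧≡true⇔ P⇔Q)

  isLub-Bool⇔ : {P : Bool → Set} {b : Bool} → IsLub _≤_ P b ⇔ (b ≡ true ⇔ P true)
  isLub-Bool⇔ {P} {b} = mk⇔ fromLub toLub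
    where
      falseBound : ¬ P true → ∀ c → P c → c ≤ false
      falseBound _  false _ = b≤b
      falseBound ¬p true  p = ⊥-elim (¬p p)
      fromLub : IsLub _≤_ P b → b ≡ true ⇔ P true
      fromLub (upper , least) = mk⇔ witness (λ p → ≤⇒true→true (upper true p) refl)
        where
          witness : b ≡ true → P true
          witness refl with lem {P true}
          ... | yes p = p
          ... | no ¬p with least false (falseBound ¬p)
          ... | ()
      toLub : b ≡ true ⇔ P true → IsLub _≤_ P b
      toLub b⇔P = upper , least
        where
          least : ∀ c → (∀ d → P d → d ≤ c) → b ≤ c
          least c bound = true→true⇒≤ λ b≡true → ≤⇒true→true (bound true (to b⇔P b≡true)) refl
          upper : ∀ c → P c → c ≤ b
          upper false _ = ≤-minimum b
          upper true  p = true→true⇒≤ λ _ → from b⇔P p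

  isLubᵖ⇔isUnion : {X : Set} {𝒮 : (X → Bool) → Bool} {g : X → Bool} →
    IsLub _≤ᵖ_ (λ f → 𝒮 f ≡ true) g ⇔ IsUnion 𝒮 g
  isLubᵖ⇔isUnion {X} {𝒮} {g} = mk⇔ fromLub toLub
    where
      union : X → Bool
      union x = ⟦ Intersects 𝒮 (λ f → f x) ⟧
      union-upper : ∀ f → 𝒮 f ≡ true → f ≤ᵖ union
      union-upper f 𝒮f y = true→true⇒≤ λ fy → from ⟦⟧≡true⇔ (f , 𝒮f , fy)
      fromLub : IsLub _≤ᵖ_ (λ f → 𝒮 f ≡ true) g → IsUnion 𝒮 g
      fromLub (upper , least) x =
        mk⇔ (to ⟦⟧≡true⇔ ∘ ≤⇒true→true (least union union-upper x))
            (λ (f , 𝒮f , fx) → ≤⇒true→true (upper f 𝒮f x) fx)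
      toLub : IsUnion 𝒮 g → IsLub _≤ᵖ_ (λ f → 𝒮 f ≡ true) g
      toLub g-union =
          (λ f 𝒮f x → true→true⇒≤ λ fx → from (g-union x) (f , 𝒮f , fx))
        , (λ c bound x → true→true⇒≤ λ gx →
             let (f , 𝒮f , fx) = to (g-union x) gx in ≤⇒true→true (bound f 𝒮f x) fx)

  joinPreserving⇔preservesUnions : {X : Set} {ξ : (X → Bool) → Bool} →
    JoinPreserving ξ ⇔ PreservesUnions ξ
  joinPreserving⇔preservesUnions = mk⇔
    (λ jp 𝒮 g g-union → to isLub-Bool⇔ (jp 𝒮 g (from isLubᵖ⇔isUnion g-union)))
    (λ pu 𝒮 g g-lub → from isLub-Bool⇔ (pu 𝒮 g (to isLubᵖ⇔isUnion g-lub)))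

  σʳ-preservesUnions : {X : Set} (S : 𝒫 X) → PreservesUnions (σʳ S)
  σʳ-preservesUnions S 𝒮 g g-union = mk⇔ toUnion fromUnion
    where
      toUnion : σʳ S g ≡ true → Intersects 𝒮 (σʳ S)
      toUnion e with to ⟦⟧≡true⇔ e
      ... | (x , Sx , gx) with to (g-union x) gx
      ... | (f , 𝒮f , fx) = f , 𝒮f , from ⟦⟧≡true⇔ (x , Sx , fx)
      fromUnion : Intersects 𝒮 (σʳ S) → σʳ S g ≡ true
      fromUnion (f , 𝒮f , e) with to ⟦⟧≡true⇔ e
      ... | (x , Sx , fx) = from ⟦⟧≡true⇔ (x , Sx , from (g-union x) (f , 𝒮f , fx))

  σʳ-jp : {X : Set} (S : 𝒫 X) → JoinPreserving (σʳ S)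
  σʳ-jp S = from joinPreserving⇔preservesUnions (σʳ-preservesUnions S)

  σ : {X : Set} → 𝒫 X → T X
  σ S = σʳ S , σʳ-jp S

  intersects-𝒫map : {X Y : Set} {g : X → Y} {S : 𝒫 X} {h : Y → Bool} →
    Intersects (𝒫map g S) h ⇔ Intersects S (h ∘ g)
  intersects-𝒫map {g = g} {S} {h} =
    mk⇔ toImage (λ (x , Sx , hgx) → g x , from ⟦⟧≡true⇔ (x , Sx , refl) , hgx)
    where
      toImage : Intersects (𝒫map g S) h → Intersects S (h ∘ g)
      toImage (y , e , hy) with to ⟦⟧≡true⇔ e
      ... | (x , Sx , refl) = x , Sx , hy

  intersects-𝒫η : {X : Set} {x : X} {S : 𝒫 X} → Intersects S (𝒫η x) ⇔ S x ≡ true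
  intersects-𝒫η {x = x} {S} = mk⇔ toPoint (λ Sx → x , Sx , from ⟦⟧≡true⇔ refl)
    where
      toPoint : Intersects S (𝒫η x) → S x ≡ true
      toPoint (y , Sy , e) with to ⟦⟧≡true⇔ e
      ... | refl = Sy

  intersects-𝒫μ : {X : Set} {𝒜 : 𝒫 (𝒫 X)} {f : X → Bool} →
    Intersects (𝒫μ 𝒜) f ⇔ Intersects 𝒜 (λ S → σʳ S f)
  intersects-𝒫μ {𝒜 = 𝒜} {f} = mk⇔ toMember fromMember
    where
      toMember : Intersects (𝒫μ 𝒜) f → Intersects 𝒜 (λ S → σʳ S f)
      toMember (x , e , fx) with to ⟦⟧≡true⇔ e
      ... | (S , 𝒜S , Sx) = S , 𝒜S , from ⟦⟧≡true⇔ (x , Sx , fx)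
      fromMember : Intersects 𝒜 (λ S → σʳ S f) → Intersects (𝒫μ 𝒜) f
      fromMember (S , 𝒜S , e) with to ⟦⟧≡true⇔ e
      ... | (x , Sx , fx) = x , from ⟦⟧≡true⇔ (S , 𝒜S , Sx) , fx

  isUnion-singletons : {X : Set} (f : 𝒫 X) → IsUnion (𝒫map 𝒫η f) f
  isUnion-singletons f x =
    mk⇔ (λ fx → 𝒫η x , from ⟦⟧≡true⇔ (x , fx , refl) , from ⟦⟧≡true⇔ refl) fromUnion
    where
      fromUnion : Intersects (𝒫map 𝒫η f) (λ k → k x) → f x ≡ true
      fromUnion (k , e , kx) with to ⟦⟧≡true⇔ e
      ... | (y , fy , refl) with to ⟦⟧≡true⇔ kx
      ... | refl = fy

  support : {X : Set} → T X → 𝒫 X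
  support ξ x = proj₁ ξ (𝒫η x)

  intersects-support : {X : Set} (ξ : T X) (f : X → Bool) →
    proj₁ ξ f ≡ true ⇔ Intersects (support ξ) f
  intersects-support ξ f = ⇔-trans
    (to joinPreserving⇔preservesUnions (proj₂ ξ) (𝒫map 𝒫η f) f (isUnion-singletons f))
    (⇔-trans intersects-𝒫map intersects-comm)

  σ∘support : {X : Set} (ξ : T X) → σ (support ξ) ≡ ξ
  σ∘support ξ = T-≡ ext (sym (ext λ f → ≡⟦⟧ (intersects-support ξ f)))

  support∘σ : {X : Set} (S : 𝒫 X) → support (σ S) ≡ S
  support∘σ S = ext λ x → sym (≡⟦⟧ (⇔-sym intersects-𝒫η))

  σʳ-𝒫map : {X Y : Set} {g : X → Y} {S : 𝒫 X} → σʳ (𝒫map g S) ≡ tmapʳ g (σʳ S)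
  σʳ-𝒫map = ext λ h → ⟦⟧-cong intersects-𝒫map

  σʳ-𝒫η : {X : Set} {x : X} → σʳ (𝒫η x) ≡ etaʳ x
  σʳ-𝒫η = ext λ f → sym (≡⟦⟧ (⇔-sym (⇔-trans intersects-comm intersects-𝒫η)))

  σʳ-𝒫μ : {X : Set} {𝒜 : 𝒫 (𝒫 X)} → σʳ (𝒫μ 𝒜) ≡ muʳ (tmapʳ σ (σʳ 𝒜))
  σʳ-𝒫μ = ext λ f → ⟦⟧-cong intersects-𝒫μ

  tmapʳ≡σʳ-image : {X Y : Set} (g : X → Y) (ξ : T X) →
    tmapʳ g (proj₁ ξ) ≡ σʳ (𝒫map g (support ξ))
  tmapʳ≡σʳ-image g ξ = begin
    tmapʳ g (proj₁ ξ)              ≡⟨ cong (tmapʳ g ∘ proj₁) (σ∘support ξ) ⟨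
    tmapʳ g (σʳ (support ξ))       ≡⟨ σʳ-𝒫map ⟨
    σʳ (𝒫map g (support ξ))        ∎
    where open ≡-Reasoning

  muʳ≡σʳ-union : {X : Set} (Ξ : T (T X)) →
    muʳ (proj₁ Ξ) ≡ σʳ (𝒫μ (𝒫map support (support Ξ)))
  -- tmapʳ is strictly functorial, so the first step only inserts σ ∘ support = id.
  muʳ≡σʳ-union Ξ = begin
    muʳ (proj₁ Ξ)                                    ≡⟨ cong (λ r → muʳ (tmapʳ r (proj₁ Ξ))) (ext σ∘support) ⟨
    muʳ (tmapʳ σ (tmapʳ support (proj₁ Ξ)))          ≡⟨ cong (muʳ ∘ tmapʳ σ ∘ tmapʳ support ∘ proj₁) (σ∘support Ξ) ⟨
    muʳ (tmapʳ σ (tmapʳ support (σʳ (support Ξ))))   ≡⟨ cong (muʳ ∘ tmapʳ σ) σʳ-𝒫map ⟨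
    muʳ (tmapʳ σ (σʳ (𝒫map support (support Ξ))))    ≡⟨ σʳ-𝒫μ ⟨
    σʳ (𝒫μ (𝒫map support (support Ξ)))               ∎
    where open ≡-Reasoning

  wellDefined : WellDefined
  wellDefined = record
    { tmap-jp = λ g ξ → subst JoinPreserving (sym (tmapʳ≡σʳ-image g ξ)) (σʳ-jp _)
    ; eta-jp  = λ x → subst JoinPreserving σʳ-𝒫η (σʳ-jp _)
    ; mu-jp   = λ Ξ → subst JoinPreserving (sym (muʳ≡σʳ-union Ξ)) (σʳ-jp _)
    }

  isMonad : IsMonad (TMonad wellDefined)
  isMonad = record
    { fmap-id    = λ _ → T-≡ ext refl
    ; fmap-∘     = λ _ _ _ → T-≡ ext refl
    ; unit-nat   = λ _ _ → T-≡ ext refl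
    ; join-nat   = λ _ _ → T-≡ ext refl
    ; left-unit  = λ _ → T-≡ ext refl
    ; right-unit = λ _ → T-≡ ext refl
    ; assoc      = λ _ → T-≡ ext refl
    }

  isMonadIso : IsMonadIso PowMonad (TMonad wellDefined) σ
  isMonadIso = record
    { natural   = λ _ _ → T-≡ ext σʳ-𝒫map
    ; unit-pres = λ _ → T-≡ ext σʳ-𝒫η
    ; join-pres = λ _ → T-≡ ext σʳ-𝒫μ
    ; bijective = inverseᵇ⇒bijective
        (strictlyInverseˡ⇒inverseˡ {f⁻¹ = support} σ σ∘support
        , strictlyInverseʳ⇒inverseʳ {f⁻¹ = support} σ support∘σ)
    }

lemma2p1 : (lem : ExcludedMiddle 0ℓ) → Extensionality 0ℓ 0ℓ →
    Σ[ wd ∈ WellDefined ] (IsMonad (TMonad wd) ×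
      Σ[ σ-jp ∈ (∀ {X : Set} (S : Classical.𝒫 lem X) → JoinPreserving (Classical.σʳ lem S)) ]
        IsMonadIso (Classical.PowMonad lem) (TMonad wd) (λ S → Classical.σʳ lem S , σ-jp S))
lemma2p1 lem ext = wellDefined , isMonad , σʳ-jp , isMonadIso
  where open Correspondence lem ext
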